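{- Let $\mathcal{R}$ be a weak rectangulation of size $n$. Then $\mathcal{R}$ avoids the pattern $\top$ (i.e. every vertical segment of $\mathcal{R}$ has its upper endpoint on the top side of the bounding rectangle) if and only if the permutation $\beta(\mathcal{R})\in S_n$ avoids the permutation pattern $213$.
   Context: A rectangulation of an axis-aligned rectangle $R$ is a decomposition of $R$ into finitely many interior-disjoint axis-aligned rectangles; its size is the number of rectangles. A segment is a maximal straight line segment which is a union of sides of rectangles and is not contained in the boundary of $R$. Rectangulations are generic: no two segments cross, so every endpoint of a segment lies either on the boundary of $R$ or in the interior of a perpendicular segment. The sides of $R$ are $\mathrm{N}$ (top), $\mathrm{S}$ (bottom), $\mathrm{W}$ (left), $\mathrm{E}$ (right). For rectangles $X,Y$: $Y$ is right of $X$ ($X$ is left of $Y$) if there is a sequence $X=X_1,\dots,X_k=Y$ such that for every $i$ there is a vertical segment containing the right side of $X_i$ and the left side of $X_{i+1}$; $Y$ is above $X$ ($X$ is below $Y$) if there is such a sequence with horizontal segments containing the top side of $X_i$ and the bottom side of $X_{i+1}$. Every pair of distinct rectangles satisfies exactly one of: left of, right of, above, below. Two rectangulations are weakly equivalent if there is a bijection between their rectangles preserving the left–right and above–below relations; a weak rectangulation is a weak equivalence class. A (weak) rectangulation avoids the pattern $\top$ if no vertical segment has its upper endpoint in the interior of a horizontal segment. The SE–NW ordering of the rectangles is the linear order with $X\prec Y$ iff $X$ is right of or below $Y$; the SW–NE ordering is the linear order with $X\prec Y$ iff $X$ is left of or below $Y$. The permutation $\beta(\mathcal{R})=\pi_1\cdots\pi_n$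 is defined by: label the rectangles $1,\dots,n$ according to the SE–NW ordering, and let $\pi_j$ be the label of the $j$-th rectangle in the SW–NE ordering. A permutation avoids $213$ if it has no indices $i<j<k$ with $\pi_j<\pi_i<\pi_k$. -}

module Defs where

open import Data.Nat using (ℕ; zero; suc; _+_; _∸_; _≤_; _<_)
open import Data.Fin using (Fin)
open import Data.Product using (Σ; ∃; _×_; _,_)
open import Data.Sum using (_⊎_)
open import Relation.Nullary using (¬_)
open import Relation.Binary.PropositionalEquality using (_≡_; _≢_)
open import Relation.Binary.Construct.Closure.Transitive using (TransClosure)
open import Function.Bundles using (_↔_; Inverse)

record Rect : Set where
  constructor rect
  field
    x₀ x₁ y₀ y₁ : ℕ

open Rect public

-- A rectangulation of size n of the bounding rectangle R = [0,W] × [0,H]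
-- (coordinates are natural numbers).
record Rectangulation (n : ℕ) : Set where
  field
    W H      : ℕ
    W-pos    : 0 < W
    H-pos    : 0 < H
    rects    : Fin n → Rect
    proper   : ∀ i → x₀ (rects i) < x₁ (rects i) × y₀ (rects i) < y₁ (rects i)
    inside   : ∀ i → x₁ (rects i) ≤ W × y₁ (rects i) ≤ H
    disjoint : ∀ i j → i ≢ j →
               ¬ ( (x₀ (rects i) < x₁ (rects j) × x₀ (rects j) < x₁ (rects i))
                 × (y₀ (rects i) < y₁ (rects j) × y₀ (rects j) < y₁ (rects i)))
    -- the rectangles cover R: every unit cell [a,a+1]×[b,b+1] of R lies in some rectangle
    cover    : ∀ a b → a < W → b < H →
               ∃ λ i → (x₀ (rects i) ≤ a × suc a ≤ x₁ (rects i))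
                     × (y₀ (rects i) ≤ b × suc b ≤ y₁ (rects i))

module _ {n : ℕ} (𝓡 : Rectangulation n) where
  open Rectangulation 𝓡

  -- the unit vertical edge {c} × [j, j+1] lies on a (left or right) side of a rectangle
  VEdge : ℕ → ℕ → Set
  VEdge c j = ∃ λ i → (x₀ (rects i) ≡ c ⊎ x₁ (rects i) ≡ c)
                    × (y₀ (rects i) ≤ j × suc j ≤ y₁ (rects i))

  -- the unit horizontal edge [j, j+1] × {d} lies on a (bottom or top) side of a rectangle
  HEdge : ℕ → ℕ → Set
  HEdge d j = ∃ λ i → (y₀ (rects i) ≡ d ⊎ y₁ (rects i) ≡ d)
                    × (x₀ (rects i) ≤ j × suc j ≤ x₁ (rects i))

  -- {c} × [a,b] is a vertical segment: a maximal vertical line segment which is a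
  -- union of sides of rectangles and is not contained in the boundary of R
  -- (i.e. 0 < c < W).
  VSeg : ℕ → ℕ → ℕ → Set
  VSeg c a b = (0 < c × c < W) × a < b
             × (∀ j → a ≤ j → j < b → VEdge c j)
             × (a ≡ 0 ⊎ ¬ VEdge c (a ∸ 1))
             × ¬ VEdge c b

  -- [a,b] × {d} is a horizontal segment
  HSeg : ℕ → ℕ → ℕ → Set
  HSeg d a b = (0 < d × d < H) × a < b
             × (∀ j → a ≤ j → j < b → HEdge d j)
             × (a ≡ 0 ⊎ ¬ HEdge d (a ∸ 1))
             × ¬ HEdge d b

  Generic : Set
  Generic = ∀ c a b d e f → VSeg c a b → HSeg d e f →
            ¬ ((a < d × d < b) × (e < c × c < f))

  -- R avoids ⊤: no vertical segment has its upper endpoint (c,b) in the interior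
  -- of a horizontal segment
  AvoidsTop : Set
  AvoidsTop = ¬ (∃ λ c → ∃ λ a → ∃ λ b → ∃ λ e → ∃ λ f →
                 VSeg c a b × HSeg b e f × (e < c × c < f))

  LeftAdj : Fin n → Fin n → Set
  LeftAdj X Y = ∃ λ c → ∃ λ a → ∃ λ b → VSeg c a b
              × (x₁ (rects X) ≡ c × x₀ (rects Y) ≡ c)
              × (a ≤ y₀ (rects X) × y₁ (rects X) ≤ b)
              × (a ≤ y₀ (rects Y) × y₁ (rects Y) ≤ b)

  BelowAdj : Fin n → Fin n → Set
  BelowAdj X Y = ∃ λ d → ∃ λ a → ∃ λ b → HSeg d a b
               × (y₁ (rects X) ≡ d × y₀ (rects Y) ≡ d)
               × (a ≤ x₀ (rects X) × x₁ (rects X) ≤ b)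
               × (a ≤ x₀ (rects Y) × x₁ (rects Y) ≤ b)

  LeftOf : Fin n → Fin n → Set
  LeftOf = TransClosure LeftAdj

  Below : Fin n → Fin n → Set
  Below = TransClosure BelowAdj

  SE≺ : Fin n → Fin n → Set
  SE≺ X Y = LeftOf Y X ⊎ Below X Y

  SW≺ : Fin n → Fin n → Set
  SW≺ X Y = LeftOf X Y ⊎ Below X Y

  -- σ labels the rectangles according to the SE–NW ordering
  -- (labels 0,…,n-1 instead of 1,…,n)
  IsSELabelling : (Fin n → Fin n) → Set
  IsSELabelling σ = ∀ X Y → (σ X Data.Fin.< σ Y → SE≺ X Y) × (SE≺ X Y → σ X Data.Fin.< σ Y)

  IsSWLabelling : (Fin n ↔ Fin n) → Set
  IsSWLabelling τ = ∀ X Y → (Inverse.to τ X Data.Fin.< Inverse.to τ Y → SW≺ X Y)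
                          × (SW≺ X Y → Inverse.to τ X Data.Fin.< Inverse.to τ Y)

  -- β(R) given the two labellings: π_j = SE–NW label of the j-th rectangle in SW–NE order
  β : (σ : Fin n → Fin n) (τ : Fin n ↔ Fin n) → Fin n → Fin n
  β σ τ j = σ (Inverse.from τ j)

Avoids213 : {n : ℕ} → (Fin n → Fin n) → Set
Avoids213 {n} π = ∀ (i j k : Fin n) → i Data.Fin.< j → j Data.Fin.< k →
                  ¬ (π j Data.Fin.< π i × π i Data.Fin.< π k)

-- A ⊤ at the point (c, b) puts three rectangles around it: X below-left and Y
-- below-right of the vertical segment's end, Z above the horizontal segment.
-- Then X is left of Y and both are below Z, so the labels of X, Y, Z in the
-- SW–NE order form a 213 pattern in β.  Conversely, a 213 pattern at positions
-- A, B, C of β means A is left of B while both lie below C.  Without ⊤ the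
-- vertical segment carrying the right side of A runs up to the top of R, and by
-- genericity no horizontal segment crosses it; hence a below-chain from A stays
-- to the left of it, and symmetrically a below-chain from B stays to the right
-- of the segment carrying the left side of B.  So C would lie both left of the
-- right side of A and right of the left side of B, which is impossible.
module Submission where

open import Defs
open import Level using (Level)
open import Data.Nat using (ℕ; zero; suc; _+_; _∸_; _≤_; _<_; z≤n; s≤s; s≤s⁻¹; _≟_; _≤?_; _<?_)
open import Data.Nat.Properties
open import Data.Fin using (Fin) renaming (_<_ to _<ᶠ_; _≟_ to _≟ᶠ_)
import Data.Fin.Properties as Fin
open import Data.Product using (∃; ∃₂; _×_; _,_; proj₁; proj₂)
open import Data.Sum using (_⊎_; inj₁; inj₂)
open import Data.Empty using (⊥; ⊥-elim)
open import Function using (_∘_)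
open import Relation.Nullary using (¬_; yes; no; contradiction)
open import Relation.Nullary.Decidable using (_×-dec_; _⊎-dec_)
open import Relation.Unary using (Decidable)
open import Relation.Binary.Definitions using (_Respects_)
open import Relation.Binary.PropositionalEquality using (_≡_; refl; sym; trans; subst; subst₂)
open import Relation.Binary.Construct.Closure.Transitive using (TransClosure; [_]; _∷_)
open import Function.Bundles using (_↔_; _⇔_; Inverse; mk⇔)

module _ {a ℓ : Level} {A : Set a} {_∼_ : A → A → Set ℓ} where

  respects⁺ : ∀ {p} {P : A → Set p} → P Respects _∼_ → P Respects (TransClosure _∼_)
  respects⁺ resp [ x∼y ]      = resp x∼y
  respects⁺ resp (x∼y ∷ y∼⁺z) = respects⁺ resp y∼⁺z ∘ resp x∼y

  first-step : ∀ {x y} → TransClosure _∼_ x y → ∃ (x ∼_)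
  first-step [ x∼y ]   = _ , x∼y
  first-step (x∼y ∷ _) = _ , x∼y

  last-step : ∀ {x y} → TransClosure _∼_ x y → ∃ (_∼ y)
  last-step [ x∼y ]      = _ , x∼y
  last-step (_ ∷ y∼⁺z) = last-step y∼⁺z

share-cell⇒overlap : ∀ {a b lo hi j} → a ≤ j → j < b → lo ≤ j → j < hi → a < hi × lo < b
share-cell⇒overlap a≤j j<b lo≤j j<hi = ≤-<-trans a≤j j<hi , ≤-<-trans lo≤j j<b

module MaximalRun {p} {P : ℕ → Set p} (P? : Decidable P) where

  Run : ℕ → ℕ → Set p
  Run l r = ∀ j → l ≤ j → j < r → P j

  -- VSeg and HSeg are maximal runs of unit edges.
  IsMaximalRun : ℕ → ℕ → Set p
  IsMaximalRun l r = Run l r × (l ≡ 0 ⊎ ¬ P (l ∸ 1)) × ¬ P r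

  extendʳ : ∀ {l r} → P r → Run l r → Run l (suc r)
  extendʳ {r = r} Pr run j l≤j j≤r with j ≟ r
  ... | yes refl = Pr
  ... | no j≢r   = run j l≤j (≤∧≢⇒< (s≤s⁻¹ j≤r) j≢r)

  extendˡ : ∀ {l r} → P l → Run (suc l) r → Run l r
  extendˡ {l} Pl run j l≤j j<r with l ≟ j
  ... | yes refl = Pl
  ... | no l≢j   = run j (≤∧≢⇒< l≤j l≢j) j<r

  maximalˡ : ∀ {l r} → Run l r → ∃ λ e → e ≤ l × Run e r × (e ≡ 0 ⊎ ¬ P (e ∸ 1))
  maximalˡ {zero} run = 0 , z≤n , run , inj₁ refl
  maximalˡ {suc l} run with P? l
  ... | no ¬Pl = suc l , ≤-refl , run , inj₂ ¬Pl
  ... | yes Pl with e , e≤l , run′ , start ← maximalˡ (extendˡ Pl run) =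
    e , m≤n⇒m≤1+n e≤l , run′ , start

  module _ {B : ℕ} (bounded : ∀ j → P j → j < B) where

    maximalʳ : ∀ {l r} → Run l r → ∃ λ f → r ≤ f × Run l f × ¬ P f
    maximalʳ {l} {r} = go B r (m≤m+n B r)
      where
      go : ∀ k m → B ≤ k + m → Run l m → ∃ λ f → m ≤ f × Run l f × ¬ P f
      go zero m B≤m run = m , ≤-refl , run , λ Pm → <⇒≱ (bounded m Pm) B≤m
      go (suc k) m B≤k+m run with P? m
      ... | no ¬Pm = m , ≤-refl , run , ¬Pm
      ... | yes Pm with f , m<f , run′ , end ←
              go k (suc m) (subst (B ≤_) (sym (+-suc k m)) B≤k+m) (extendʳ Pm run) =
        f , <⇒≤ m<f , run′ , end

    maximal : ∀ {l r} → Run l r → ∃₂ λ e f → e ≤ l × r ≤ f × IsMaximalRun e f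
    maximal run with f , r≤f , runʳ , end ← maximalʳ run
                with e , e≤l , run′ , start ← maximalˡ runʳ =
      e , f , e≤l , r≤f , run′ , start , end

module Geometry {n : ℕ} (𝓡 : Rectangulation n) where
  open Rectangulation 𝓡

  left right bottom top : Fin n → ℕ
  left   P = x₀ (rects P)
  right  P = x₁ (rects P)
  bottom P = y₀ (rects P)
  top    P = y₁ (rects P)

  Covers : Fin n → ℕ → ℕ → Set
  Covers P u v = (left P ≤ u × u < right P) × (bottom P ≤ v × v < top P)

  overlap⇒≡ : ∀ P Q → left P < right Q → left Q < right P →
              bottom P < top Q → bottom Q < top P → P ≡ Q
  overlap⇒≡ P Q lP<rQ lQ<rP bP<tQ bQ<tP with P ≟ᶠ Q
  ... | yes P≡Q = P≡Q
  ... | no P≢Q  = contradiction ((lP<rQ , lQ<rP) , (bP<tQ , bQ<tP)) (disjoint P Q P≢Q)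

  VEdge-avoids-interior : ∀ {c j} P → VEdge 𝓡 c j → bottom P ≤ j → j < top P →
                          ¬ (left P < c × c < right P)
  VEdge-avoids-interior P (Q , inj₁ refl , bQ≤j , j<tQ) bP≤j j<tP (lP<c , c<rP)
    with refl ← overlap⇒≡ P Q (<-trans lP<c (proj₁ (proper Q))) c<rP
                              (≤-<-trans bP≤j j<tQ) (≤-<-trans bQ≤j j<tP)
    = <-irrefl refl lP<c
  VEdge-avoids-interior P (Q , inj₂ refl , bQ≤j , j<tQ) bP≤j j<tP (lP<c , c<rP)
    with refl ← overlap⇒≡ P Q lP<c (<-trans (proj₁ (proper Q)) c<rP)
                              (≤-<-trans bP≤j j<tQ) (≤-<-trans bQ≤j j<tP)
    = <-irrefl refl c<rP

  HEdge-avoids-interior : ∀ {d j} P → HEdge 𝓡 d j → left P ≤ j → j < right P →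
                          ¬ (bottom P < d × d < top P)
  HEdge-avoids-interior P (Q , inj₁ refl , lQ≤j , j<rQ) lP≤j j<rP (bP<d , d<tP)
    with refl ← overlap⇒≡ P Q (≤-<-trans lP≤j j<rQ) (≤-<-trans lQ≤j j<rP)
                              (<-trans bP<d (proj₂ (proper Q))) d<tP
    = <-irrefl refl bP<d
  HEdge-avoids-interior P (Q , inj₂ refl , lQ≤j , j<rQ) lP≤j j<rP (bP<d , d<tP)
    with refl ← overlap⇒≡ P Q (≤-<-trans lP≤j j<rQ) (≤-<-trans lQ≤j j<rP)
                              bP<d (<-trans (proj₂ (proper Q)) d<tP)
    = <-irrefl refl d<tP

  VEdge⇒left≡ : ∀ {P c j} → Covers P c j → VEdge 𝓡 c j → left P ≡ c
  VEdge⇒left≡ {P} ((lP≤c , c<rP) , (bP≤j , j<tP)) edge =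
    ≤∧≮⇒≡ lP≤c (λ lP<c → VEdge-avoids-interior P edge bP≤j j<tP (lP<c , c<rP))

  VEdge⇒right≡ : ∀ {P c j} → Covers P c j → VEdge 𝓡 (suc c) j → right P ≡ suc c
  VEdge⇒right≡ {P} ((lP≤c , c<rP) , (bP≤j , j<tP)) edge =
    sym (≤∧≮⇒≡ c<rP (λ c+1<rP → VEdge-avoids-interior P edge bP≤j j<tP (s≤s lP≤c , c+1<rP)))

  HEdge⇒bottom≡ : ∀ {P u d} → Covers P u d → HEdge 𝓡 d u → bottom P ≡ d
  HEdge⇒bottom≡ {P} ((lP≤u , u<rP) , (bP≤d , d<tP)) edge =
    ≤∧≮⇒≡ bP≤d (λ bP<d → HEdge-avoids-interior P edge lP≤u u<rP (bP<d , d<tP))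

  HEdge⇒top≡ : ∀ {P u d} → Covers P u d → HEdge 𝓡 (suc d) u → top P ≡ suc d
  HEdge⇒top≡ {P} ((lP≤u , u<rP) , (bP≤d , d<tP)) edge =
    sym (≤∧≮⇒≡ d<tP (λ d+1<tP → HEdge-avoids-interior P edge lP≤u u<rP (s≤s bP≤d , d+1<tP)))

  VSeg-start≤bottom : ∀ {c a b} P → VSeg 𝓡 c a b → (left P ≡ c ⊎ right P ≡ c) →
                      a < top P → a ≤ bottom P
  VSeg-start≤bottom {a = zero} _ _ _ _ = z≤n
  VSeg-start≤bottom {a = suc a} P (_ , _ , _ , inj₂ ¬edge , _) side a<tP =
    ≮⇒≥ (λ bP<a → ¬edge (P , side , s≤s⁻¹ bP<a , <⇒≤ a<tP))

  VSeg-top≤end : ∀ {c a b} P → VSeg 𝓡 c a b → (left P ≡ c ⊎ right P ≡ c) →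
                 bottom P < b → top P ≤ b
  VSeg-top≤end P (_ , _ , _ , _ , ¬edge) side bP<b =
    ≮⇒≥ (λ b<tP → ¬edge (P , side , <⇒≤ bP<b , b<tP))

  HSeg-start≤left : ∀ {d e f} P → HSeg 𝓡 d e f → (bottom P ≡ d ⊎ top P ≡ d) →
                    e < right P → e ≤ left P
  HSeg-start≤left {e = zero} _ _ _ _ = z≤n
  HSeg-start≤left {e = suc e} P (_ , _ , _ , inj₂ ¬edge , _) side e<rP =
    ≮⇒≥ (λ lP<e → ¬edge (P , side , s≤s⁻¹ lP<e , <⇒≤ e<rP))

  HSeg-right≤end : ∀ {d e f} P → HSeg 𝓡 d e f → (bottom P ≡ d ⊎ top P ≡ d) →
                   left P < f → right P ≤ f
  HSeg-right≤end P (_ , _ , _ , _ , ¬edge) side lP<f =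
    ≮⇒≥ (λ f<rP → ¬edge (P , side , <⇒≤ lP<f , f<rP))

  LeftAdj-intro : ∀ {c a b X Y} → VSeg 𝓡 c a b → right X ≡ c → left Y ≡ c →
                  a < top X × bottom X < b → a < top Y × bottom Y < b → LeftAdj 𝓡 X Y
  LeftAdj-intro {c} {a} {b} {X} {Y} seg rX≡c lY≡c (a<tX , bX<b) (a<tY , bY<b) =
    c , a , b , seg , (rX≡c , lY≡c) ,
    (VSeg-start≤bottom X seg (inj₂ rX≡c) a<tX , VSeg-top≤end X seg (inj₂ rX≡c) bX<b) ,
    (VSeg-start≤bottom Y seg (inj₁ lY≡c) a<tY , VSeg-top≤end Y seg (inj₁ lY≡c) bY<b)

  BelowAdj-intro : ∀ {d e f X Z} → HSeg 𝓡 d e f → top X ≡ d → bottom Z ≡ d →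
                   e < right X × left X < f → e < right Z × left Z < f → BelowAdj 𝓡 X Z
  BelowAdj-intro {d} {e} {f} {X} {Z} seg tX≡d bZ≡d (e<rX , lX<f) (e<rZ , lZ<f) =
    d , e , f , seg , (tX≡d , bZ≡d) ,
    (HSeg-start≤left X seg (inj₂ tX≡d) e<rX , HSeg-right≤end X seg (inj₂ tX≡d) lX<f) ,
    (HSeg-start≤left Z seg (inj₁ bZ≡d) e<rZ , HSeg-right≤end Z seg (inj₁ bZ≡d) lZ<f)

  corner-cells-adjacent : ∀ {c a b e f X Y Z} → VSeg 𝓡 (suc c) a (suc b) → HSeg 𝓡 (suc b) e f →
                          e < suc c → suc c < f →
                          Covers X c b → Covers Y (suc c) b → Covers Z (suc c) (suc b) →
                          LeftAdj 𝓡 X Y × BelowAdj 𝓡 X Z × BelowAdj 𝓡 Y Z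
  corner-cells-adjacent {c} {a} {b} {e} {f} vseg@(_ , a<b , vedges , _) hseg@(_ , _ , hedges , _)
                        e<c+1 c+1<f covX covY covZ =
    LeftAdj-intro vseg (VEdge⇒right≡ covX vedge) (VEdge⇒left≡ covY vedge) (row covX) (row covY) ,
    BelowAdj-intro hseg (HEdge⇒top≡ covX hedgeˡ) (HEdge⇒bottom≡ covZ hedgeʳ)
                   (column covX e≤c c<f) (column covZ (<⇒≤ e<c+1) c+1<f) ,
    BelowAdj-intro hseg (HEdge⇒top≡ covY hedgeʳ) (HEdge⇒bottom≡ covZ hedgeʳ)
                   (column covY (<⇒≤ e<c+1) c+1<f) (column covZ (<⇒≤ e<c+1) c+1<f)
    where
    e≤c : e ≤ c
    e≤c = s≤s⁻¹ e<c+1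
    c<f : c < f
    c<f = <⇒≤ c+1<f
    vedge : VEdge 𝓡 (suc c) b
    vedge = vedges b (s≤s⁻¹ a<b) ≤-refl
    hedgeˡ : HEdge 𝓡 (suc b) c
    hedgeˡ = hedges c e≤c c<f
    hedgeʳ : HEdge 𝓡 (suc b) (suc c)
    hedgeʳ = hedges (suc c) (<⇒≤ e<c+1) c+1<f
    row : ∀ {P u} → Covers P u b → a < top P × bottom P < suc b
    row (_ , (bP≤b , b<tP)) = share-cell⇒overlap (s≤s⁻¹ a<b) ≤-refl bP≤b b<tP
    column : ∀ {P u v} → Covers P u v → e ≤ u → u < f → e < right P × left P < f
    column ((lP≤u , u<rP) , _) e≤u u<f = share-cell⇒overlap e≤u u<f lP≤u u<rP

  ⊤⇒configuration : ∀ {c a b e f} → VSeg 𝓡 c a b → HSeg 𝓡 b e f → e < c → c < f →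
                    ∃₂ λ X Y → ∃ λ Z → LeftAdj 𝓡 X Y × BelowAdj 𝓡 X Z × BelowAdj 𝓡 Y Z
  ⊤⇒configuration {zero} ((() , _) , _) _ _ _
  ⊤⇒configuration {b = zero} (_ , () , _) _ _ _
  ⊤⇒configuration {suc c} {b = suc b} vseg@((_ , c<W) , _) hseg@((_ , b<H) , _) e<c c<f
    with X , covX ← cover c b (<⇒≤ c<W) (<⇒≤ b<H)
       | Y , covY ← cover (suc c) b c<W (<⇒≤ b<H)
       | Z , covZ ← cover (suc c) (suc b) c<W b<H =
    X , Y , Z , corner-cells-adjacent vseg hseg e<c c<f covX covY covZ

  HEdge? : ∀ d → Decidable (HEdge 𝓡 d)
  HEdge? d j = Fin.any? λ P → ((bottom P ≟ d) ⊎-dec (top P ≟ d))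
                              ×-dec ((left P ≤? j) ×-dec (j <? right P))

  HEdge-bounded : ∀ {d} j → HEdge 𝓡 d j → j < W
  HEdge-bounded j (Q , _ , _ , j<rQ) = <-≤-trans j<rQ (proj₁ (inside Q))

  bottom-side-in-HSeg : ∀ {d} P → 0 < d → d < H → bottom P ≡ d →
                        ∃₂ λ e f → HSeg 𝓡 d e f × e ≤ left P × right P ≤ f
  bottom-side-in-HSeg {d} P 0<d d<H bP≡d
    with e , f , e≤lP , rP≤f , maximal-run ←
           MaximalRun.maximal (HEdge? d) HEdge-bounded (λ j lP≤j j<rP → P , inj₁ bP≡d , lP≤j , j<rP) =
    e , f , ((0<d , d<H) , ≤-<-trans e≤lP (<-≤-trans (proj₁ (proper P)) rP≤f) , maximal-run) , e≤lP , rP≤f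

  straddles-VSeg-end : ∀ {c a b P} → VSeg 𝓡 (suc c) a (suc b) → Covers P c (suc b) →
                       bottom P ≡ suc b × suc c < right P
  straddles-VSeg-end {c} {a} {b} {P} (_ , a<b , vedges , _ , ¬edge) ((lP≤c , c<rP) , (bP≤b+1 , b+1<tP)) =
    ≤∧≮⇒≡ bP≤b+1 (λ bP<b+1 → VEdge-avoids-interior P (vedges b (s≤s⁻¹ a<b) ≤-refl)
                                 (s≤s⁻¹ bP<b+1) (<⇒≤ b+1<tP) (s≤s lP≤c , c+1<rP)) ,
    c+1<rP
    where
    c+1<rP : suc c < right P
    c+1<rP = ≤∧≢⇒< c<rP (λ c+1≡rP → ¬edge (P , inj₂ (sym c+1≡rP) , bP≤b+1 , b+1<tP))

  VSeg-below-top⇒⊤ : ∀ {c a b} → VSeg 𝓡 c a b → b < H →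
                     ∃₂ λ e f → HSeg 𝓡 b e f × (e < c × c < f)
  VSeg-below-top⇒⊤ {zero} ((() , _) , _) _
  VSeg-below-top⇒⊤ {b = zero} (_ , () , _) _
  VSeg-below-top⇒⊤ {suc c} {b = suc b} vseg@((_ , c<W) , _) b<H
    with P , covP@((lP≤c , _) , _) ← cover c (suc b) (<⇒≤ c<W) b<H
    with bP≡b+1 , c+1<rP ← straddles-VSeg-end vseg covP
    with e , f , hseg , e≤lP , rP≤f ← bottom-side-in-HSeg P (s≤s z≤n) b<H bP≡b+1 =
    e , f , hseg , ≤-<-trans e≤lP (s≤s lP≤c) , <-≤-trans c+1<rP rP≤f

  avoidsTop⇒VSeg-reaches-top : AvoidsTop 𝓡 → ∀ {c a b} → VSeg 𝓡 c a b → H ≤ b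
  avoidsTop⇒VSeg-reaches-top avoids vseg = ≮⇒≥ λ b<H →
    let e , f , hseg , straddle = VSeg-below-top⇒⊤ vseg b<H
    in avoids (_ , _ , _ , e , f , vseg , hseg , straddle)

  -- A below-step leaving the left of a full-height vertical segment would cross it.
  BelowAdj-stays-left : Generic 𝓡 → ∀ {c a b} → VSeg 𝓡 c a b → H ≤ b →
                        (λ Z → right Z ≤ c × a < top Z) Respects BelowAdj 𝓡
  BelowAdj-stays-left generic {c} {a} {b} vseg H≤b {X} {Z}
    (d , e , f , hseg@((_ , d<H) , _) , (tX≡d , bZ≡d) , (e≤lX , _) , (_ , rZ≤f)) (rX≤c , a<tX) =
    ≤-trans rZ≤f f≤c , <-trans (subst (a <_) (trans tX≡d (sym bZ≡d)) a<tX) (proj₂ (proper Z))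
    where
    f≤c : f ≤ c
    f≤c = ≮⇒≥ λ c<f → generic c a b d e f vseg hseg
            ((subst (a <_) tX≡d a<tX , <-≤-trans d<H H≤b) ,
             (≤-<-trans e≤lX (<-≤-trans (proj₁ (proper X)) rX≤c) , c<f))

  BelowAdj-stays-right : Generic 𝓡 → ∀ {c a b} → VSeg 𝓡 c a b → H ≤ b →
                         (λ Z → c ≤ left Z × a < top Z) Respects BelowAdj 𝓡
  BelowAdj-stays-right generic {c} {a} {b} vseg H≤b {X} {Z}
    (d , e , f , hseg@((_ , d<H) , _) , (tX≡d , bZ≡d) , (_ , rX≤f) , (e≤lZ , _)) (c≤lX , a<tX) =
    ≤-trans c≤e e≤lZ , <-trans (subst (a <_) (trans tX≡d (sym bZ≡d)) a<tX) (proj₂ (proper Z))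
    where
    c≤e : c ≤ e
    c≤e = ≮⇒≥ λ e<c → generic c a b d e f vseg hseg
            ((subst (a <_) tX≡d a<tX , <-≤-trans d<H H≤b) ,
             (e<c , ≤-<-trans c≤lX (<-≤-trans (proj₁ (proper X)) rX≤f)))

  module _ (generic : Generic 𝓡) (avoids : AvoidsTop 𝓡) where

    LeftAdj⇒Below-right≤right : ∀ {X Y Z} → LeftAdj 𝓡 X Y → Below 𝓡 X Z → right Z ≤ right X
    LeftAdj⇒Below-right≤right {X} (c , a , b , vseg , (rX≡c , _) , (a≤bX , _) , _) X<Z =
      ≤-trans (proj₁ (respects⁺ stays X<Z (≤-reflexive rX≡c , ≤-<-trans a≤bX (proj₂ (proper X)))))
              (≤-reflexive (sym rX≡c))
      where
      stays : (λ Z → right Z ≤ c × a < top Z) Respects BelowAdj 𝓡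
      stays = BelowAdj-stays-left generic vseg (avoidsTop⇒VSeg-reaches-top avoids vseg)

    LeftAdj⇒Below-left≤left : ∀ {X Y Z} → LeftAdj 𝓡 X Y → Below 𝓡 Y Z → left Y ≤ left Z
    LeftAdj⇒Below-left≤left {Y = Y} (c , a , b , vseg , (_ , lY≡c) , _ , (a≤bY , _)) Y<Z =
      ≤-trans (≤-reflexive lY≡c)
              (proj₁ (respects⁺ stays Y<Z (≤-reflexive (sym lY≡c) , ≤-<-trans a≤bY (proj₂ (proper Y)))))
      where
      stays : (λ Z → c ≤ left Z × a < top Z) Respects BelowAdj 𝓡
      stays = BelowAdj-stays-right generic vseg (avoidsTop⇒VSeg-reaches-top avoids vseg)

  LeftOf⇒right≤left : ∀ {X Y} → LeftOf 𝓡 X Y → right X ≤ left Y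
  LeftOf⇒right≤left [ (_ , _ , _ , _ , (rX≡c , lY≡c) , _) ] = ≤-reflexive (trans rX≡c (sym lY≡c))
  LeftOf⇒right≤left (_∷_ {y = Y} X◁Y Y<Z) =
    ≤-trans (LeftOf⇒right≤left [ X◁Y ]) (<⇒≤ (<-≤-trans (proj₁ (proper Y)) (LeftOf⇒right≤left Y<Z)))

  Below⇒top≤bottom : ∀ {X Y} → Below 𝓡 X Y → top X ≤ bottom Y
  Below⇒top≤bottom [ (_ , _ , _ , _ , (tX≡d , bY≡d) , _) ] = ≤-reflexive (trans tX≡d (sym bY≡d))
  Below⇒top≤bottom (_∷_ {y = Y} X△Y Y<Z) =
    ≤-trans (Below⇒top≤bottom [ X△Y ]) (<⇒≤ (<-≤-trans (proj₂ (proper Y)) (Below⇒top≤bottom Y<Z)))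

  LeftOf-asym : ∀ {X Y} → LeftOf 𝓡 X Y → ¬ LeftOf 𝓡 Y X
  LeftOf-asym {X} {Y} X<Y Y<X =
    <-asym (<-≤-trans (proj₁ (proper X)) (LeftOf⇒right≤left X<Y))
           (<-≤-trans (proj₁ (proper Y)) (LeftOf⇒right≤left Y<X))

  Below-asym : ∀ {X Y} → Below 𝓡 X Y → ¬ Below 𝓡 Y X
  Below-asym {X} {Y} X<Y Y<X =
    <-asym (<-≤-trans (proj₂ (proper X)) (Below⇒top≤bottom X<Y))
           (<-≤-trans (proj₂ (proper Y)) (Below⇒top≤bottom Y<X))

  SW≺∧SE≻⇒LeftOf : ∀ {X Y} → SW≺ 𝓡 X Y → SE≺ 𝓡 Y X → LeftOf 𝓡 X Y
  SW≺∧SE≻⇒LeftOf (inj₁ X<Y) _          = X<Y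
  SW≺∧SE≻⇒LeftOf (inj₂ _)   (inj₁ X<Y) = X<Y
  SW≺∧SE≻⇒LeftOf (inj₂ X<Y) (inj₂ Y<X) = ⊥-elim (Below-asym X<Y Y<X)

  SW≺∧SE≺⇒Below : ∀ {X Y} → SW≺ 𝓡 X Y → SE≺ 𝓡 X Y → Below 𝓡 X Y
  SW≺∧SE≺⇒Below _          (inj₂ X<Y) = X<Y
  SW≺∧SE≺⇒Below (inj₂ X<Y) (inj₁ _)   = X<Y
  SW≺∧SE≺⇒Below (inj₁ X<Y) (inj₁ Y<X) = ⊥-elim (LeftOf-asym X<Y Y<X)

  no-213-configuration : Generic 𝓡 → AvoidsTop 𝓡 →
                         ∀ {X Y Z} → LeftOf 𝓡 X Y → Below 𝓡 X Z → Below 𝓡 Y Z → ⊥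
  no-213-configuration generic avoids {X} {Y} {Z} X<Y X<Z Y<Z =
    <⇒≱ (proj₁ (proper Z)) (begin
      right Z ≤⟨ LeftAdj⇒Below-right≤right generic avoids (proj₂ (first-step X<Y)) X<Z ⟩
      right X ≤⟨ LeftOf⇒right≤left X<Y ⟩
      left Y  ≤⟨ LeftAdj⇒Below-left≤left generic avoids (proj₂ (last-step X<Y)) Y<Z ⟩
      left Z  ∎)
    where open ≤-Reasoning

module Labellings {n : ℕ} (𝓡 : Rectangulation n) (σ : Fin n → Fin n) (τ : Fin n ↔ Fin n)
                 (se : IsSELabelling 𝓡 σ) (sw : IsSWLabelling 𝓡 τ) where
  open Inverse τ using (to; from; strictlyInverseˡ; strictlyInverseʳ)

  SW≺-from : ∀ {i j} → i <ᶠ j → SW≺ 𝓡 (from i) (from j)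
  SW≺-from {i} {j} = proj₁ (sw (from i) (from j))
                   ∘ subst₂ _<ᶠ_ (sym (strictlyInverseˡ i)) (sym (strictlyInverseˡ j))

  SE≺-from : ∀ {i j} → β 𝓡 σ τ i <ᶠ β 𝓡 σ τ j → SE≺ 𝓡 (from i) (from j)
  SE≺-from {i} {j} = proj₁ (se (from i) (from j))

  SW≺⇒to< : ∀ {X Y} → SW≺ 𝓡 X Y → to X <ᶠ to Y
  SW≺⇒to< {X} {Y} = proj₂ (sw X Y)

  SE≺⇒β-to< : ∀ {X Y} → SE≺ 𝓡 X Y → β 𝓡 σ τ (to X) <ᶠ β 𝓡 σ τ (to Y)
  SE≺⇒β-to< {X} {Y} = subst₂ (λ U V → σ U <ᶠ σ V) (sym (strictlyInverseʳ X)) (sym (strictlyInverseʳ Y))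
                    ∘ proj₂ (se X Y)

theorem2 : (n : ℕ) (𝓡 : Rectangulation n) → Generic 𝓡 →
    (σ : Fin n → Fin n) (τ : Fin n ↔ Fin n) →
    IsSELabelling 𝓡 σ → IsSWLabelling 𝓡 τ →
    AvoidsTop 𝓡 ⇔ Avoids213 (β 𝓡 σ τ)
theorem2 n 𝓡 generic σ τ se sw = mk⇔ avoids213 avoidsTop
  where
  open Geometry 𝓡
  open Labellings 𝓡 σ τ se sw
  open Inverse τ using (to)

  avoids213 : AvoidsTop 𝓡 → Avoids213 (β 𝓡 σ τ)
  avoids213 avoids i j k i<j j<k (βj<βi , βi<βk) =
    no-213-configuration generic avoids
      (SW≺∧SE≻⇒LeftOf (SW≺-from i<j) (SE≺-from βj<βi))
      (SW≺∧SE≺⇒Below (SW≺-from (Fin.<-trans i<j j<k)) (SE≺-from βi<βk))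
      (SW≺∧SE≺⇒Below (SW≺-from j<k) (SE≺-from (Fin.<-trans βj<βi βi<βk)))

  avoidsTop : Avoids213 (β 𝓡 σ τ) → AvoidsTop 𝓡
  avoidsTop avoids (_ , _ , _ , _ , _ , vseg , hseg , e<c , c<f) =
    let X , Y , Z , X◁Y , X△Z , Y△Z = ⊤⇒configuration vseg hseg e<c c<f
    in avoids (to X) (to Y) (to Z) (SW≺⇒to< (inj₁ [ X◁Y ])) (SW≺⇒to< (inj₂ [ Y△Z ]))
              (SE≺⇒β-to< (inj₁ [ X◁Y ]) , SE≺⇒β-to< (inj₂ [ X△Z ]))
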